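{- Let $n\ge 1$, let $P=(p_1,\ldots,p_n)$ be positive integers, and let $m\ge 0$ and $k\ge 0$ be integers. Then for every integer $s\ge 1$, $$F(n,k,P,m)=\sum_{i=0}^{s}(-1)^i\binom{s}{i}F(n,k+s,P,m+s-i).$$
   Context: Let $P=(p_1,\ldots,p_n)$ be a finite list of positive integers (repetitions allowed) and $m\ge 0$ an integer. Let $X$ be a finite set which is the disjoint union of "main blocks" $X_1,\ldots,X_n$ with $|X_i|=p_i$ and an "additional block" $X_{n+1}$ with $|X_{n+1}|=m$. For an integer $k\ge 0$, $F(n,k,P,m)$ denotes the number of subsets $U\subseteq X$ with $|U|=n+k$ such that $U\cap X_i\neq\emptyset$ for every $i=1,\ldots,n$. For $k<0$ one sets $F(n,k,P,m)=0$. -}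

module Defs where

open import Data.Bool using (Bool; true; false; _∧_; _∨_)
open import Data.Nat using (ℕ; zero; suc; _+_; _∸_; _≡ᵇ_)
open import Data.List using (List; []; _∷_; _++_; map; length; filterᵇ)
open import Data.Vec using (Vec; []; _∷_; splitAt; sum)
open import Data.Product using (_,_)
open import Data.Fin.Subset using (Subset; ∣_∣)
open import Data.Integer as ℤ using (ℤ)

allSubsets : (p : ℕ) → List (Subset p)
allSubsets zero = [] ∷ []
allSubsets (suc p) = map (true ∷_) (allSubsets p) ++ map (false ∷_) (allSubsets p)

nonemptyᵇ : ∀ {p} → Subset p → Bool
nonemptyᵇ [] = false
nonemptyᵇ (b ∷ u) = b ∨ nonemptyᵇ u

-- X = X_1 ⊔ ... ⊔ X_n ⊔ X_{n+1} is modelled as Fin (p_1 + ... + p_n + m),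
-- the blocks being consecutive segments (in this order).
-- hitsAllᵇ P u : u meets each main block X_1, ..., X_n.
hitsAllᵇ : ∀ {n} (P : Vec ℕ n) → Subset (sum P) → Bool
hitsAllᵇ [] _ = true
hitsAllᵇ (p ∷ P) u with splitAt p u
... | (a , b , _) = nonemptyᵇ a ∧ hitsAllᵇ P b

mainPart : ∀ {n} (P : Vec ℕ n) (m : ℕ) → Subset (sum P + m) → Subset (sum P)
mainPart P m u with splitAt (sum P) u
... | (a , _ , _) = a

F : (n k : ℕ) (P : Vec ℕ n) (m : ℕ) → ℕ
F n k P m = length (filterᵇ (λ u → (∣ u ∣ ≡ᵇ (n + k)) ∧ hitsAllᵇ P (mainPart P m u))
                            (allSubsets (sum P + m)))

sumℤUpTo : ℕ → (ℕ → ℤ) → ℤ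
sumℤUpTo zero f = f zero
sumℤUpTo (suc s) f = sumℤUpTo s f ℤ.+ f (suc s)

module Submission where

-- Enlarging the additional block by one new element x splits
-- the admissible subsets of size t+1 into those containing x (an admissible
-- subset of size t of the old set, plus x) and those avoiding x, so
--
--     F(n, k+1, P, m+1) = F(n, k, P, m) + F(n, k+1, P, m).          (Pascal)
--
-- The theorem is then a consequence of this recurrence alone: for any
-- integer-valued f(t, m) satisfying f(t+1, m+1) = f(t, m) + f(t+1, m),
--
--     f(t, m) = Σ_{i ≤ s} (-1)^i C(s,i) f(t+s, m+s-i)    for every s,
--
-- by induction on s: rewriting every term f(t+s, m+s-i) as the difference
-- f(t+s+1, m+s+1-i) - f(t+s+1, m+s-i) turns the alternating binomial sum of
-- order s into that of order s+1, by Pascal's rule for binomials.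

open import Defs
open import Data.Nat using (ℕ; _+_; _∸_; _≤_; zero; suc; _≡ᵇ_; z≤n)
open import Data.Nat.Combinatorics using (_C_; nCk+nC[k+1]≡[n+1]C[k+1]; k>n⇒nCk≡0)
open import Data.Vec using (Vec; _∷_; take; sum)
open import Data.Vec.Relation.Unary.All using (All)
open import Data.Integer using (ℤ; +_; -1ℤ; _*_; _^_)
open import Relation.Binary.PropositionalEquality using (_≡_; refl; sym; trans; cong; cong₂; module ≡-Reasoning)
open import Data.Bool using (Bool; true; false; _∧_)
open import Data.List using (List; []; _∷_; _++_; map; length; filterᵇ)
open import Data.Fin.Subset using (Subset; ∣_∣)
open import Function using (_∘_)
import Data.Nat.Properties as ℕP
import Data.Integer as ℤ
import Data.Integer.Properties as ℤP
open import Data.Integer.Tactic.RingSolver using (solve-∀)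

open ≡-Reasoning

countᵇ : {A : Set} → (A → Bool) → List A → ℕ
countᵇ p xs = length (filterᵇ p xs)

countᵇ-++ : {A : Set} (p : A → Bool) (xs ys : List A) →
  countᵇ p (xs ++ ys) ≡ countᵇ p xs + countᵇ p ys
countᵇ-++ p [] ys = refl
countᵇ-++ p (x ∷ xs) ys with p x
... | true  = cong suc (countᵇ-++ p xs ys)
... | false = countᵇ-++ p xs ys

countᵇ-map : {A B : Set} (p : B → Bool) (f : A → B) (xs : List A) →
  countᵇ p (map f xs) ≡ countᵇ (p ∘ f) xs
countᵇ-map p f [] = refl
countᵇ-map p f (x ∷ xs) with p (f x)
... | true  = cong suc (countᵇ-map p f xs)
... | false = countᵇ-map p f xs

countᵇ-allSubsets-suc : (x : ℕ) (p : Subset (suc x) → Bool) →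
  countᵇ p (allSubsets (suc x))
    ≡ countᵇ (p ∘ (true ∷_)) (allSubsets x) + countᵇ (p ∘ (false ∷_)) (allSubsets x)
countᵇ-allSubsets-suc x p = begin
  countᵇ p (map (true ∷_) S ++ map (false ∷_) S)
    ≡⟨ countᵇ-++ p (map (true ∷_) S) (map (false ∷_) S) ⟩
  countᵇ p (map (true ∷_) S) + countᵇ p (map (false ∷_) S)
    ≡⟨ cong₂ _+_ (countᵇ-map p (true ∷_) S) (countᵇ-map p (false ∷_) S) ⟩
  countᵇ (p ∘ (true ∷_)) S + countᵇ (p ∘ (false ∷_)) S ∎
  where
  S : List (Subset x)
  S = allSubsets x

prefixCount : (a : ℕ) → (Subset a → Bool) → (ℕ → Bool) → ℕ → ℕ
prefixCount a h g m = countᵇ (λ u → g ∣ u ∣ ∧ h (take a u)) (allSubsets (a + m))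

F-as-prefixCount : ∀ n k (P : Vec ℕ n) m →
  F n k P m ≡ prefixCount (sum P) (hitsAllᵇ P) (_≡ᵇ n + k) m
F-as-prefixCount n k P m = refl

+-interchange : (a b c d : ℕ) → (a + b) + (c + d) ≡ (a + c) + (b + d)
+-interchange a b c d = begin
  (a + b) + (c + d)   ≡⟨ ℕP.+-assoc a b (c + d) ⟩
  a + (b + (c + d))   ≡⟨ cong (λ z → a + z) (ℕP.+-assoc b c d) ⟨
  a + ((b + c) + d)   ≡⟨ cong (λ z → a + (z + d)) (ℕP.+-comm b c) ⟩
  a + ((c + b) + d)   ≡⟨ cong (λ z → a + z) (ℕP.+-assoc c b d) ⟩
  a + (c + (b + d))   ≡⟨ ℕP.+-assoc a c (b + d) ⟨
  (a + c) + (b + d)   ∎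

-- Pascal recurrence: one more unconstrained element either lies in u (and
-- raises its size by one) or not.  Proved by peeling off the constrained
-- prefix element by element until the new element comes first.
prefixCount-pascal : (a : ℕ) (h : Subset a → Bool) (g : ℕ → Bool) (m : ℕ) →
  prefixCount a h g (suc m) ≡ prefixCount a h (g ∘ suc) m + prefixCount a h g m
prefixCount-pascal zero h g m = countᵇ-allSubsets-suc m _
prefixCount-pascal (suc a) h g m = begin
  prefixCount (suc a) h g (suc m)
    ≡⟨ countᵇ-allSubsets-suc (a + suc m) _ ⟩
  prefixCount a h₁ (g ∘ suc) (suc m) + prefixCount a h₀ g (suc m)
    ≡⟨ cong₂ _+_ (prefixCount-pascal a h₁ (g ∘ suc) m) (prefixCount-pascal a h₀ g m) ⟩
  (prefixCount a h₁ (g ∘ suc ∘ suc) m + prefixCount a h₁ (g ∘ suc) m)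
    + (prefixCount a h₀ (g ∘ suc) m + prefixCount a h₀ g m)
    ≡⟨ +-interchange (prefixCount a h₁ (g ∘ suc ∘ suc) m) (prefixCount a h₁ (g ∘ suc) m)
                     (prefixCount a h₀ (g ∘ suc) m) (prefixCount a h₀ g m) ⟩
  (prefixCount a h₁ (g ∘ suc ∘ suc) m + prefixCount a h₀ (g ∘ suc) m)
    + (prefixCount a h₁ (g ∘ suc) m + prefixCount a h₀ g m)
    ≡⟨ cong₂ _+_ (countᵇ-allSubsets-suc (a + m) _) (countᵇ-allSubsets-suc (a + m) _) ⟨
  prefixCount (suc a) h (g ∘ suc) m + prefixCount (suc a) h g m ∎
  where
  h₁ h₀ : Subset a → Bool
  h₁ u = h (true ∷ u)
  h₀ u = h (false ∷ u)

sum-cong : ∀ s {f g : ℕ → ℤ} → (∀ i → i ≤ s → f i ≡ g i) → sumℤUpTo s f ≡ sumℤUpTo s g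
sum-cong zero    f≡g = f≡g 0 z≤n
sum-cong (suc s) f≡g =
  cong₂ ℤ._+_ (sum-cong s (λ i i≤s → f≡g i (ℕP.m≤n⇒m≤1+n i≤s))) (f≡g (suc s) ℕP.≤-refl)

sum-+ : ∀ s (f g : ℕ → ℤ) →
  sumℤUpTo s (λ i → f i ℤ.+ g i) ≡ sumℤUpTo s f ℤ.+ sumℤUpTo s g
sum-+ zero    f g = refl
sum-+ (suc s) f g = begin
  sumℤUpTo s (λ i → f i ℤ.+ g i) ℤ.+ (f (suc s) ℤ.+ g (suc s))
    ≡⟨ cong (ℤ._+ (f (suc s) ℤ.+ g (suc s))) (sum-+ s f g) ⟩
  (sumℤUpTo s f ℤ.+ sumℤUpTo s g) ℤ.+ (f (suc s) ℤ.+ g (suc s))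
    ≡⟨ interchange (sumℤUpTo s f) (sumℤUpTo s g) (f (suc s)) (g (suc s)) ⟩
  sumℤUpTo (suc s) f ℤ.+ sumℤUpTo (suc s) g ∎
  where
  interchange : ∀ a b c d → (a ℤ.+ b) ℤ.+ (c ℤ.+ d) ≡ (a ℤ.+ c) ℤ.+ (b ℤ.+ d)
  interchange = solve-∀

sum-shift : ∀ s (f : ℕ → ℤ) → sumℤUpTo (suc s) f ≡ f 0 ℤ.+ sumℤUpTo s (f ∘ suc)
sum-shift zero    f = refl
sum-shift (suc s) f = trans (cong (ℤ._+ f (suc (suc s))) (sum-shift s f)) (ℤP.+-assoc (f 0) _ _)

binomial-sum-pascal : ∀ s (a : ℕ → ℤ) →
  sumℤUpTo (suc s) (λ i → + (suc s C i) * a i)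
    ≡ sumℤUpTo s (λ i → + (s C i) * a i) ℤ.+ sumℤUpTo s (λ i → + (s C i) * a (suc i))
binomial-sum-pascal s a = begin
  sumℤUpTo (suc s) (λ i → + (suc s C i) * a i)
    ≡⟨ sum-shift s _ ⟩
  ℤ.1ℤ * a 0 ℤ.+ sumℤUpTo s (λ i → + (suc s C suc i) * a (suc i))
    ≡⟨ cong (ℤ._+_ (ℤ.1ℤ * a 0)) (sum-cong s (λ i _ → split i)) ⟩
  ℤ.1ℤ * a 0 ℤ.+ sumℤUpTo s (λ i → + (s C i) * a (suc i) ℤ.+ + (s C suc i) * a (suc i))
    ≡⟨ cong (ℤ._+_ (ℤ.1ℤ * a 0)) (sum-+ s _ _) ⟩
  ℤ.1ℤ * a 0 ℤ.+ (X ℤ.+ Y)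
    ≡⟨ regroup (a 0) X Y ⟩
  (a 0 ℤ.+ Y) ℤ.+ X
    ≡⟨ cong (ℤ._+ X) lower ⟨
  sumℤUpTo s (λ i → + (s C i) * a i) ℤ.+ X ∎
  where
  X Y : ℤ
  X = sumℤUpTo s (λ i → + (s C i) * a (suc i))
  Y = sumℤUpTo s (λ i → + (s C suc i) * a (suc i))
  split : ∀ i → + (suc s C suc i) * a (suc i) ≡ + (s C i) * a (suc i) ℤ.+ + (s C suc i) * a (suc i)
  split i = trans (cong (λ c → + c * a (suc i)) (sym (nCk+nC[k+1]≡[n+1]C[k+1] s i)))
                  (ℤP.*-distribʳ-+ (a (suc i)) (+ (s C i)) (+ (s C suc i)))
  regroup : ∀ u x y → ℤ.1ℤ * u ℤ.+ (x ℤ.+ y) ≡ (u ℤ.+ y) ℤ.+ x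
  regroup = solve-∀
  C0≡1 : ∀ n → + (n C 0) ≡ ℤ.1ℤ
  C0≡1 zero    = refl
  C0≡1 (suc n) = refl
  -- the order-s sum may be extended by the vanishing term C(s,s+1) a_{s+1}
  lower : sumℤUpTo s (λ i → + (s C i) * a i) ≡ a 0 ℤ.+ Y
  lower = begin
    sumℤUpTo s (λ i → + (s C i) * a i)
      ≡⟨ ℤP.+-identityʳ _ ⟨
    sumℤUpTo s (λ i → + (s C i) * a i) ℤ.+ ℤ.0ℤ
      ≡⟨ cong (λ c → sumℤUpTo s (λ i → + (s C i) * a i) ℤ.+ + c * a (suc s))
              (k>n⇒nCk≡0 {s} {suc s} ℕP.≤-refl) ⟨
    sumℤUpTo (suc s) (λ i → + (s C i) * a i)
      ≡⟨ sum-shift s _ ⟩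
    + (s C 0) * a 0 ℤ.+ Y
      ≡⟨ cong (λ c → c * a 0 ℤ.+ Y) (C0≡1 s) ⟩
    ℤ.1ℤ * a 0 ℤ.+ Y
      ≡⟨ cong (ℤ._+ Y) (ℤP.*-identityˡ (a 0)) ⟩
    a 0 ℤ.+ Y ∎

altBinomialSum : ℕ → (ℕ → ℤ) → ℤ
altBinomialSum s b = sumℤUpTo s (λ i → (-1ℤ ^ i) * (+ (s C i)) * b i)

altBinomialSum-cong : ∀ s {b c : ℕ → ℤ} → (∀ i → i ≤ s → b i ≡ c i) →
  altBinomialSum s b ≡ altBinomialSum s c
altBinomialSum-cong s b≡c = sum-cong s (λ i i≤s → cong ((-1ℤ ^ i) * (+ (s C i)) *_) (b≡c i i≤s))

altBinomialSum-difference : ∀ s (b : ℕ → ℤ) →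
  altBinomialSum s (λ i → b i ℤ.- b (suc i)) ≡ altBinomialSum (suc s) b
altBinomialSum-difference s b = begin
  altBinomialSum s (λ i → b i ℤ.- b (suc i))
    ≡⟨ sum-cong s (λ i _ → spread (-1ℤ ^ i) (+ (s C i)) (b i) (b (suc i))) ⟩
  sumℤUpTo s (λ i → + (s C i) * a i ℤ.+ + (s C i) * a (suc i))
    ≡⟨ sum-+ s _ _ ⟩
  sumℤUpTo s (λ i → + (s C i) * a i) ℤ.+ sumℤUpTo s (λ i → + (s C i) * a (suc i))
    ≡⟨ binomial-sum-pascal s a ⟨
  sumℤUpTo (suc s) (λ i → + (suc s C i) * a i)
    ≡⟨ sum-cong (suc s) (λ i _ → reassociate (-1ℤ ^ i) (+ (suc s C i)) (b i)) ⟩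
  altBinomialSum (suc s) b ∎
  where
  -- signed values; a (suc i) unfolds to (-1) * (-1)^i * b (suc i)
  a : ℕ → ℤ
  a i = (-1ℤ ^ i) * b i
  spread : ∀ x c u v → x * c * (u ℤ.- v) ≡ c * (x * u) ℤ.+ c * ((-1ℤ * x) * v)
  spread = solve-∀
  reassociate : ∀ x c u → c * (x * u) ≡ x * c * u
  reassociate = solve-∀

pascal-inversion : (f : ℕ → ℕ → ℤ) →
  (∀ t m → f (suc t) (suc m) ≡ f t m ℤ.+ f (suc t) m) →
  ∀ s t m → f t m ≡ altBinomialSum s (λ i → f (t + s) ((m + s) ∸ i))
pascal-inversion f rec zero t m = sym (begin
  ℤ.1ℤ * f (t + 0) (m + 0)   ≡⟨ ℤP.*-identityˡ _ ⟩
  f (t + 0) (m + 0)          ≡⟨ cong₂ f (ℕP.+-identityʳ t) (ℕP.+-identityʳ m) ⟩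
  f t m                      ∎)
pascal-inversion f rec (suc s) t m = begin
  f t m
    ≡⟨ pascal-inversion f rec s t m ⟩
  altBinomialSum s (λ i → f (t + s) ((m + s) ∸ i))
    ≡⟨ altBinomialSum-cong s as-difference ⟩
  altBinomialSum s (λ i → b i ℤ.- b (suc i))
    ≡⟨ altBinomialSum-difference s b ⟩
  altBinomialSum (suc s) b
    ≡⟨ altBinomialSum-cong (suc s) (λ i _ →
         sym (cong₂ (λ t′ m′ → f t′ (m′ ∸ i)) (ℕP.+-suc t s) (ℕP.+-suc m s))) ⟩
  altBinomialSum (suc s) (λ i → f (t + suc s) ((m + suc s) ∸ i)) ∎
  where
  b : ℕ → ℤ
  b i = f (suc (t + s)) (suc (m + s) ∸ i)
  cancel : ∀ y z → y ≡ (y ℤ.+ z) ℤ.- z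
  cancel = solve-∀
  -- the recurrence solved for f(t', m'), at t' = t+s and m' = m+s-i
  as-difference : ∀ i → i ≤ s → f (t + s) ((m + s) ∸ i) ≡ b i ℤ.- b (suc i)
  as-difference i i≤s = begin
    f (t + s) (m + s ∸ i)
      ≡⟨ cancel _ _ ⟩
    (f (t + s) (m + s ∸ i) ℤ.+ b (suc i)) ℤ.- b (suc i)
      ≡⟨ cong (ℤ._- b (suc i)) (rec (t + s) (m + s ∸ i)) ⟨
    f (suc (t + s)) (suc (m + s ∸ i)) ℤ.- b (suc i)
      ≡⟨ cong (λ m′ → f (suc (t + s)) m′ ℤ.- b (suc i))
              (ℕP.+-∸-assoc 1 (ℕP.≤-trans i≤s (ℕP.m≤n+m s m))) ⟨
    b i ℤ.- b (suc i) ∎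

theorem3 : (n : ℕ) → 1 ≤ n → (P : Vec ℕ n) → All (λ p → 1 ≤ p) P →
    (m k s : ℕ) → 1 ≤ s →
    + F n k P m ≡ sumℤUpTo s (λ i → (-1ℤ ^ i) * (+ (s C i)) * (+ F n (k + s) P ((m + s) ∸ i)))
theorem3 n _ P _ m k s _ = begin
  + F n k P m
    ≡⟨ cong +_ (F-as-prefixCount n k P m) ⟩
  admissible (n + k) m
    ≡⟨ pascal-inversion admissible pascal s (n + k) m ⟩
  altBinomialSum s (λ i → admissible (n + k + s) ((m + s) ∸ i))
    ≡⟨ altBinomialSum-cong s (λ i _ → cong (λ t → admissible t ((m + s) ∸ i)) (ℕP.+-assoc n k s)) ⟩
  altBinomialSum s (λ i → admissible (n + (k + s)) ((m + s) ∸ i))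
    ≡⟨ altBinomialSum-cong s (λ i _ → cong +_ (F-as-prefixCount n (k + s) P ((m + s) ∸ i))) ⟨
  altBinomialSum s (λ i → + F n (k + s) P ((m + s) ∸ i)) ∎
  where
  admissible : ℕ → ℕ → ℤ
  admissible t m′ = + prefixCount (sum P) (hitsAllᵇ P) (_≡ᵇ t) m′
  pascal : ∀ t m′ → admissible (suc t) (suc m′) ≡ admissible t m′ ℤ.+ admissible (suc t) m′
  pascal t m′ = cong +_ (prefixCount-pascal (sum P) (hitsAllᵇ P) (_≡ᵇ suc t) m′)
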